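{- Every system of weakly-guarded contractions $\{X_i\succeq E_i\}_{i\in I}$ (with no restriction on the use of sums) has a unique solution for rooted bisimilarity: if $\tilde P$ and $\tilde Q$ satisfy $P_i\succeq^c_{\mathrm{bis}}E_i[\tilde P]$ and $Q_i\succeq^c_{\mathrm{bis}}E_i[\tilde Q]$ for all $i\in I$, then $P_i\approx^c Q_i$ for all $i\in I$ (and hence also $P_i\approx Q_i$).
   Context: CCS processes over names $\mathscr L$ (actions $\mu ::= \tau\mid a\mid\overline a$): $P ::= \mathbf 0 \mid \mu.P \mid P_1|P_2 \mid P_1+P_2 \mid (\nu a)P \mid A \mid \mathrm{rec}\,A.\,P \mid P[rf]$, with the standard SOS semantics. $\Rightarrow^{\epsilon}$ is the reflexive–transitive closure of $\xrightarrow{\tau}$; $P\Rightarrow^{\mu}P'$ means $P\Rightarrow^{\epsilon}\xrightarrow{\mu}\Rightarrow^{\epsilon}P'$; $P\,\widehat{\Rightarrow^{\mu}}\,P'$ means $P\Rightarrow^{\mu}P'$ or ($\mu=\tau$ and $P=P'$); $P\,\widehat{\xrightarrow{\mu}}\,P'$ means $P\xrightarrow{\mu}P'$ or ($\mu=\tau$, $P=P'$). Weak bisimilarity $\approx$: largest relation such that whenever $P\approx Q$, $P\xrightarrow{\mu}P'$ implies $Q\,\widehat{\Rightarrow^{\mu}}\,Q'$ with $P'\approx Q'$, and symmetrically. Rooted bisimilarity: $P\approx^c Q$ iff $P\xrightarrow{\mu}P'$ implies $Q\Rightarrow^{\mu}Q'$ with $P'\approx Q'$, and $Q\xrightarrow{\mu}Q'$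 implies $P\Rightarrow^{\mu}P'$ with $P'\approx Q'$. Bisimilarity contraction $\succeq_{\mathrm{bis}}$: $P\succeq_{\mathrm{bis}}Q$ iff $P\mathcal R Q$ for some relation $\mathcal R$ such that whenever $P\mathcal RQ$: $P\xrightarrow{\mu}P'$ implies $Q\,\widehat{\xrightarrow{\mu}}\,Q'$ with $P'\mathcal RQ'$, and $Q\xrightarrow{\mu}Q'$ implies $P\,\widehat{\Rightarrow^{\mu}}\,P'$ with $P'\approx Q'$. Rooted contraction: $P\succeq^c_{\mathrm{bis}}Q$ iff $P\xrightarrow{\mu}P'$ implies $Q\xrightarrow{\mu}Q'$ with $P'\succeq_{\mathrm{bis}}Q'$, and $Q\xrightarrow{\mu}Q'$ implies $P\Rightarrow^{\mu}P'$ with $P'\approx Q'$. A system of contractions $\{X_i\succeq E_i\}_{i\in I}$ ($I$ countable) consists of CCS expressions $E_i$ possibly containing variables $X_j$; $E[\tilde P]$ is syntactic replacement of each $X_j$ by $P_j$. It is weakly guarded if in each $E_i$ every occurrence of a variable lies underneath a prefix $\mu.\,$. -}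

module Defs where

open import Data.Nat using (ℕ; zero; suc)
open import Data.Fin using (Fin; zero; suc)
open import Data.Empty using (⊥)
open import Data.Maybe using (Maybe; just; nothing)
open import Data.Product using (Σ; ∃; _×_; _,_)
open import Data.Sum using (_⊎_)
open import Relation.Binary.PropositionalEquality using (_≡_; _≢_)
open import Relation.Binary.Construct.Closure.ReflexiveTransitive using (Star)

Name : Set
Name = ℕ

data Act : Set where
  τ   : Act
  inp : Name → Act
  out : Name → Act

chan : Act → Maybe Name
chan τ       = nothing
chan (inp a) = just a
chan (out a) = just a

relAct : (Name → Name) → Act → Act
relAct f τ       = τ
relAct f (inp a) = inp (f a)
relAct f (out a) = out (f a)

-- CCS expressions.
-- V : the type of equation variables X_j;
-- n : number of recursion constants A in scope (de Bruijn indices,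
--     bound by rec).

data Expr (V : Set) : ℕ → Set where
  nil  : ∀ {n} → Expr V n
  pre  : ∀ {n} → Act → Expr V n → Expr V n
  par  : ∀ {n} → Expr V n → Expr V n → Expr V n
  sum  : ∀ {n} → Expr V n → Expr V n → Expr V n
  res  : ∀ {n} → Name → Expr V n → Expr V n
  cst  : ∀ {n} → Fin n → Expr V n
  rec  : ∀ {n} → Expr V (suc n) → Expr V n
  rel  : ∀ {n} → (Name → Name) → Expr V n → Expr V n
  var  : ∀ {n} → V → Expr V n

Proc : Set
Proc = Expr ⊥ zero

ext : ∀ {n m} → (Fin n → Fin m) → Fin (suc n) → Fin (suc m)
ext ρ zero    = zero
ext ρ (suc i) = suc (ρ i)

ren : ∀ {V n m} → (Fin n → Fin m) → Expr V n → Expr V m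
ren ρ nil         = nil
ren ρ (pre μ P)   = pre μ (ren ρ P)
ren ρ (par P Q)   = par (ren ρ P) (ren ρ Q)
ren ρ (sum P Q)   = sum (ren ρ P) (ren ρ Q)
ren ρ (res a P)   = res a (ren ρ P)
ren ρ (cst i)     = cst (ρ i)
ren ρ (rec P)     = rec (ren (ext ρ) P)
ren ρ (rel f P)   = rel f (ren ρ P)
ren ρ (var x)     = var x

exts : ∀ {V n m} → (Fin n → Expr V m) → Fin (suc n) → Expr V (suc m)
exts σ zero    = cst zero
exts σ (suc i) = ren suc (σ i)

subst : ∀ {V n m} → (Fin n → Expr V m) → Expr V n → Expr V m
subst σ nil         = nil
subst σ (pre μ P)   = pre μ (subst σ P)
subst σ (par P Q)   = par (subst σ P) (subst σ Q)
subst σ (sum P Q)   = sum (subst σ P) (subst σ Q)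
subst σ (res a P)   = res a (subst σ P)
subst σ (cst i)     = σ i
subst σ (rec P)     = rec (subst (exts σ) P)
subst σ (rel f P)   = rel f (subst σ P)
subst σ (var x)     = var x

unfold : Expr ⊥ (suc zero) → Proc
unfold P = subst (λ _ → rec P) P

closeAt : ∀ {n} → Proc → Expr ⊥ n
closeAt P = ren (λ ()) P

substX : ∀ {V n} → (V → Proc) → Expr V n → Expr ⊥ n
substX σ nil         = nil
substX σ (pre μ P)   = pre μ (substX σ P)
substX σ (par P Q)   = par (substX σ P) (substX σ Q)
substX σ (sum P Q)   = sum (substX σ P) (substX σ Q)
substX σ (res a P)   = res a (substX σ P)
substX σ (cst i)     = cst i
substX σ (rec P)     = rec (substX σ P)
substX σ (rel f P)   = rel f (substX σ P)
substX σ (var x)     = closeAt (σ x)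

_[_] : ∀ {V} → Expr V zero → (V → Proc) → Proc
E [ P ] = substX P E

data WeaklyGuarded {V : Set} : ∀ {n} → Expr V n → Set where
  nil : ∀ {n} → WeaklyGuarded {n = n} nil
  pre : ∀ {n} μ (P : Expr V n) → WeaklyGuarded (pre μ P)
  par : ∀ {n} {P Q : Expr V n} → WeaklyGuarded P → WeaklyGuarded Q → WeaklyGuarded (par P Q)
  sum : ∀ {n} {P Q : Expr V n} → WeaklyGuarded P → WeaklyGuarded Q → WeaklyGuarded (sum P Q)
  res : ∀ {n} a {P : Expr V n} → WeaklyGuarded P → WeaklyGuarded (res a P)
  cst : ∀ {n} (i : Fin n) → WeaklyGuarded (cst i)
  rec : ∀ {n} {P : Expr V (suc n)} → WeaklyGuarded P → WeaklyGuarded (rec P)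
  rel : ∀ {n} f {P : Expr V n} → WeaklyGuarded P → WeaklyGuarded (rel f P)

infix 4 _─[_]→_
data _─[_]→_ : Proc → Act → Proc → Set where
  pre   : ∀ μ P → pre μ P ─[ μ ]→ P
  sumL  : ∀ {P Q μ P'} → P ─[ μ ]→ P' → sum P Q ─[ μ ]→ P'
  sumR  : ∀ {P Q μ Q'} → Q ─[ μ ]→ Q' → sum P Q ─[ μ ]→ Q'
  parL  : ∀ {P Q μ P'} → P ─[ μ ]→ P' → par P Q ─[ μ ]→ par P' Q
  parR  : ∀ {P Q μ Q'} → Q ─[ μ ]→ Q' → par P Q ─[ μ ]→ par P Q'
  com₁  : ∀ {P Q P' Q' a} → P ─[ inp a ]→ P' → Q ─[ out a ]→ Q' → par P Q ─[ τ ]→ par P' Q'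
  com₂  : ∀ {P Q P' Q' a} → P ─[ out a ]→ P' → Q ─[ inp a ]→ Q' → par P Q ─[ τ ]→ par P' Q'
  res   : ∀ {P μ P' a} → chan μ ≢ just a → P ─[ μ ]→ P' → res a P ─[ μ ]→ res a P'
  rel   : ∀ {P μ P' f} → P ─[ μ ]→ P' → rel f P ─[ relAct f μ ]→ rel f P'
  rec   : ∀ {P μ P'} → unfold P ─[ μ ]→ P' → rec P ─[ μ ]→ P'

τstep : Proc → Proc → Set
τstep P P' = P ─[ τ ]→ P'

_⇒ε_ : Proc → Proc → Set
P ⇒ε P' = Star τstep P P'

_⇒[_]_ : Proc → Act → Proc → Set
P ⇒[ μ ] P' = Σ Proc λ P₁ → Σ Proc λ P₂ → P ⇒ε P₁ × P₁ ─[ μ ]→ P₂ × P₂ ⇒ε P'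

_⇒̂[_]_ : Proc → Act → Proc → Set
P ⇒̂[ μ ] P' = P ⇒[ μ ] P' ⊎ (μ ≡ τ × P ≡ P')

_─̂[_]→_ : Proc → Act → Proc → Set
P ─̂[ μ ]→ P' = P ─[ μ ]→ P' ⊎ (μ ≡ τ × P ≡ P')

PRel : Set₁
PRel = Proc → Proc → Set

IsWeakBisim : PRel → Set
IsWeakBisim R = ∀ {P Q} → R P Q →
  (∀ {μ P'} → P ─[ μ ]→ P' → Σ Proc λ Q' → Q ⇒̂[ μ ] Q' × R P' Q') ×
  (∀ {μ Q'} → Q ─[ μ ]→ Q' → Σ Proc λ P' → P ⇒̂[ μ ] P' × R P' Q')

_≈_ : Proc → Proc → Set₁
P ≈ Q = Σ PRel λ R → IsWeakBisim R × R P Q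

_≈ᶜ_ : Proc → Proc → Set₁
P ≈ᶜ Q =
  (∀ {μ P'} → P ─[ μ ]→ P' → Σ Proc λ Q' → Q ⇒[ μ ] Q' × P' ≈ Q') ×
  (∀ {μ Q'} → Q ─[ μ ]→ Q' → Σ Proc λ P' → P ⇒[ μ ] P' × P' ≈ Q')

IsContraction : PRel → Set₁
IsContraction R = ∀ {P Q} → R P Q →
  (∀ {μ P'} → P ─[ μ ]→ P' → Σ Proc λ Q' → Q ─̂[ μ ]→ Q' × R P' Q') ×
  (∀ {μ Q'} → Q ─[ μ ]→ Q' → Σ Proc λ P' → P ⇒̂[ μ ] P' × P' ≈ Q')

_⪰bis_ : Proc → Proc → Set₁
P ⪰bis Q = Σ PRel λ R → IsContraction R × R P Q

_⪰ᶜbis_ : Proc → Proc → Set₁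
P ⪰ᶜbis Q =
  (∀ {μ P'} → P ─[ μ ]→ P' → Σ Proc λ Q' → Q ─[ μ ]→ Q' × P' ⪰bis Q') ×
  (∀ {μ Q'} → Q ─[ μ ]→ Q' → Σ Proc λ P' → P ⇒[ μ ] P' × P' ≈ Q')

Countable : Set → Set
Countable I = Σ (I → ℕ) λ f → ∀ {i j} → f i ≡ f j → i ≡ j

module Submission where

-- Pairs (A , B) with
-- A ≈ C[P̃] and B ≈ C[Q̃] for a common expression C form a weak bisimulation.
-- A single step of C[P̃] decomposes into a static context around moves of some
-- components Pᵢ; the hypothesis answers each move by a step of Eᵢ[P̃] up to
-- contraction, weak guardedness makes that a step of Eᵢ itself and hence of
-- Eᵢ[Q̃], which Qᵢ answers weakly up to ≈. Weak transitions are then matched by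
-- induction on the transition of a process A ⪰ C[P̃]: each step of A is answered
-- by at most one step of C[P̃]. Taking C = Xᵢ gives Pᵢ ≈ Qᵢ, and the single-move
-- case gives the rooted clauses. Countability of the index set is not needed.
--
-- As ≈ and ⪰bis are large (they quantify over relations), the argument uses small
-- substitutes: closures, under reflexivity, transitivity and the static operators,
-- of the witnesses the hypotheses supply.

open import Defs
open import Data.Empty using (⊥; ⊥-elim)
open import Data.Unit using (⊤; tt)
open import Data.Nat using (ℕ; zero; suc; _⊔_; _≤′_; ≤′-refl; ≤′-step)
open import Data.Nat.Properties using (m≤m⊔n; m≤n⊔m; ≤⇒≤′)
open import Data.Fin using (Fin; zero; suc)
open import Data.Maybe using (just)
open import Data.Product using (Σ; _×_; _,_; proj₁; proj₂; swap)
open import Data.Sum using (_⊎_; inj₁; inj₂; [_,_])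
open import Function using (flip; id; _∘_)
open import Relation.Binary.Construct.Closure.ReflexiveTransitive using (ε; _◅_)
open import Relation.Binary.Construct.Union using (_∪_)
import Relation.Binary.PropositionalEquality as Eq
open Eq using (_≡_; _≢_; refl; sym; trans; cong; cong₂)

variable
  P P′ P₁ Q Q′ : Proc
  α β γ μ ν : Act
  R S : PRel

-- Composition of actions along a weak transition: τ is neutral, and a weak
-- transition carries at most one visible action.
data _·_≔_ : Act → Act → Act → Set where
  τ· : τ · μ ≔ μ
  ·τ : μ · τ ≔ μ

·-assoc : ∀ {α₁ α₂ α₁₂ α₃} → α₁ · α₂ ≔ α₁₂ → α₁₂ · α₃ ≔ α →
          Σ Act λ α₂₃ → α₂ · α₃ ≔ α₂₃ × α₁ · α₂₃ ≔ α
·-assoc τ· c = _ , c , τ·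
·-assoc ·τ c = _ , τ· , c

-- Weak transitions P =α=> P′ (the relation ⇒̂ of the paper), as sequences of
-- steps: empty only for α = τ.
infix 4 _⟹[_]_ _⟹⁺[_]_
data _⟹[_]_ : Proc → Act → Proc → Set where
  stop : P ⟹[ τ ] P
  step : β · γ ≔ α → P ─[ β ]→ P₁ → P₁ ⟹[ γ ] P′ → P ⟹[ α ] P′

-- Non-empty weak transitions (the relation ⇒ of the paper).
data _⟹⁺[_]_ : Proc → Act → Proc → Set where
  step⁺ : β · γ ≔ α → P ─[ β ]→ P₁ → P₁ ⟹[ γ ] P′ → P ⟹⁺[ α ] P′

forget : P ⟹⁺[ α ] P′ → P ⟹[ α ] P′
forget (step⁺ c t h) = step c t h

single : P ─[ μ ]→ P′ → P ⟹[ μ ] P′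
single t = step ·τ t stop

infixr 5 _++⟨_⟩_
_++⟨_⟩_ : P ⟹[ β ] Q → β · γ ≔ α → Q ⟹[ γ ] Q′ → P ⟹[ α ] Q′
stop       ++⟨ τ· ⟩ k = k
stop       ++⟨ ·τ ⟩ k = k
step c t h ++⟨ c′ ⟩ k = let (_ , c₂₃ , c₁) = ·-assoc c c′ in step c₁ t (h ++⟨ c₂₃ ⟩ k)

-- A process that can do every first step of P also does every non-empty weak
-- transition of P (used for the choice and recursion operators).
⟹⁺-redirect : (∀ {β P₁} → P ─[ β ]→ P₁ → Q ─[ β ]→ P₁) → P ⟹⁺[ α ] P′ → Q ⟹⁺[ α ] P′
⟹⁺-redirect first (step⁺ c t h) = step⁺ c (first t) h

⇒ε→⟹ : P ⇒ε P′ → P ⟹[ τ ] P′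
⇒ε→⟹ ε       = stop
⇒ε→⟹ (t ◅ s) = step τ· t (⇒ε→⟹ s)

⟹→⇒ε : P ⟹[ τ ] P′ → P ⇒ε P′
⟹→⇒ε stop          = ε
⟹→⇒ε (step τ· t h) = t ◅ ⟹→⇒ε h
⟹→⇒ε (step ·τ t h) = t ◅ ⟹→⇒ε h

⇒→⟹⁺ : P ⇒[ α ] P′ → P ⟹⁺[ α ] P′
⇒→⟹⁺ (_ , _ , s₁ , t , s₂) = prefix s₁ (step⁺ ·τ t (⇒ε→⟹ s₂))
  where
    prefix : P ⇒ε P₁ → P₁ ⟹⁺[ α ] P′ → P ⟹⁺[ α ] P′
    prefix ε       h = h
    prefix (u ◅ s) h = step⁺ τ· u (forget (prefix s h))

⟹→⇒̂ : P ⟹[ α ] P′ → P ⇒̂[ α ] P′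
nonempty→⇒ : β · γ ≔ α → P ─[ β ]→ P₁ → P₁ ⟹[ γ ] P′ → P ⇒[ α ] P′
⟹→⇒̂ stop         = inj₂ (refl , refl)
⟹→⇒̂ (step c t h) = inj₁ (nonempty→⇒ c t h)
nonempty→⇒ ·τ t h = _ , _ , ε , t , ⟹→⇒ε h
nonempty→⇒ τ· t h with ⟹→⇒̂ h
... | inj₁ (P₁ , P₂ , s₁ , u , s₂) = P₁ , P₂ , t ◅ s₁ , u , s₂
... | inj₂ (refl , refl)           = _ , _ , ε , t , ε

⇒̂→⟹ : P ⇒̂[ α ] P′ → P ⟹[ α ] P′
⇒̂→⟹ (inj₁ w)           = forget (⇒→⟹⁺ w)
⇒̂→⟹ (inj₂ (refl , refl)) = stop

─̂→⟹ : P ─̂[ α ]→ P′ → P ⟹[ α ] P′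
─̂→⟹ (inj₁ t)            = single t
─̂→⟹ (inj₂ (refl , refl)) = stop

record Lifting (F : Proc → Proc) (μ ν : Act) : Set where
  field
    keeps-τ : μ ≡ τ → ν ≡ τ
    lift-τ  : ∀ {P P′} → P ─[ τ ]→ P′ → F P ─[ τ ]→ F P′
    lift    : ∀ {P P′} → P ─[ μ ]→ P′ → F P ─[ ν ]→ F P′
open Lifting

τ-lifting : ∀ {F} → Lifting F μ ν → Lifting F τ τ
τ-lifting L = record { keeps-τ = id ; lift-τ = lift-τ L ; lift = lift-τ L }

lift-parL : ∀ B μ → Lifting (λ A → par A B) μ μ
lift-parL B μ = record { keeps-τ = id ; lift-τ = parL ; lift = parL }

lift-parR : ∀ A μ → Lifting (par A) μ μ
lift-parR A μ = record { keeps-τ = id ; lift-τ = parR ; lift = parR }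

lift-res : ∀ {a} → chan μ ≢ just a → Lifting (res a) μ μ
lift-res ne = record { keeps-τ = id ; lift-τ = res (λ ()) ; lift = res ne }

lift-rel : ∀ f μ → Lifting (rel f) μ (relAct f μ)
lift-rel f μ = record { keeps-τ = λ { refl → refl } ; lift-τ = rel ; lift = rel }

─̂-map : ∀ {F} → Lifting F μ ν → P ─̂[ μ ]→ P′ → F P ─̂[ ν ]→ F P′
─̂-map L (inj₁ t)            = inj₁ (lift L t)
─̂-map L (inj₂ (refl , refl)) = inj₂ (keeps-τ L refl , refl)

⟹-map : ∀ {F} → Lifting F μ ν → P ⟹[ μ ] P′ → F P ⟹[ ν ] F P′
⟹-map L stop rewrite keeps-τ L refl = stop
⟹-map L (step τ· t h) = step τ· (lift-τ L t) (⟹-map L h)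
⟹-map L (step ·τ t h) = step ·τ (lift L t) (⟹-map (τ-lifting L) h)

⟹⁺-map : ∀ {F} → Lifting F μ ν → P ⟹⁺[ μ ] P′ → F P ⟹⁺[ ν ] F P′
⟹⁺-map L (step⁺ τ· t h) = step⁺ τ· (lift-τ L t) (⟹-map L h)
⟹⁺-map L (step⁺ ·τ t h) = step⁺ ·τ (lift L t) (⟹-map (τ-lifting L) h)

data Complementary : Act → Act → Set where
  inp-out : ∀ {a} → Complementary (inp a) (out a)
  out-inp : ∀ {a} → Complementary (out a) (inp a)

communicate : Complementary μ ν → P ─[ μ ]→ P′ → Q ─[ ν ]→ Q′ → par P Q ─[ τ ]→ par P′ Q′
communicate inp-out = com₁
communicate out-inp = com₂

⟹-communicate : Complementary μ ν → P ⟹[ μ ] P′ → Q ⟹[ ν ] Q′ → par P Q ⟹⁺[ τ ] par P′ Q′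
⟹-communicate ()  stop _
⟹-communicate k (step τ· t h) k′ = step⁺ τ· (parL t) (forget (⟹-communicate k h k′))
⟹-communicate () (step ·τ t h) stop
⟹-communicate k (step ·τ t h) (step τ· s h′) =
  step⁺ τ· (parR s) (forget (⟹-communicate k (step ·τ t h) h′))
⟹-communicate k (step ·τ t h) (step ·τ s h′) =
  step⁺ ·τ (communicate k t s) (⟹-map (lift-parL _ τ) h ++⟨ τ· ⟩ ⟹-map (lift-parR _ τ) h′)

sharpen : μ ≢ τ → P ─̂[ μ ]→ P′ → P ─[ μ ]→ P′
sharpen _  (inj₁ t)       = t
sharpen ne (inj₂ (e , _)) = ⊥-elim (ne e)

WeakAnswers : PRel → PRel
WeakAnswers R A B = ∀ {μ A′} → A ─[ μ ]→ A′ → Σ Proc λ B′ → B ⟹[ μ ] B′ × R A′ B′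

-- Weak bisimulations, answered by weak transitions (convenient for composition).
IsWB : PRel → Set
IsWB R = ∀ {A B} → R A B → WeakAnswers R A B × WeakAnswers (flip R) B A

IsWB-flip : IsWB R → IsWB (flip R)
IsWB-flip wb r = swap (wb r)

fromIsWeakBisim : IsWeakBisim R → IsWB R
fromIsWeakBisim wb r = (λ t → let (B′ , h , r′) = proj₁ (wb r) t in B′ , ⇒̂→⟹ h , r′)
                     , (λ t → let (A′ , h , r′) = proj₂ (wb r) t in A′ , ⇒̂→⟹ h , r′)

toIsWeakBisim : IsWB R → IsWeakBisim R
toIsWeakBisim wb r = (λ t → let (B′ , h , r′) = proj₁ (wb r) t in B′ , ⟹→⇒̂ h , r′)
                   , (λ t → let (A′ , h , r′) = proj₂ (wb r) t in A′ , ⟹→⇒̂ h , r′)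

≈-relation : P ≈ Q → PRel
≈-relation = proj₁

≈-isWB : (p : P ≈ Q) → IsWB (≈-relation p)
≈-isWB p = fromIsWeakBisim (proj₁ (proj₂ p))

≈-related : (p : P ≈ Q) → ≈-relation p P Q
≈-related p = proj₂ (proj₂ p)

⪰bis-relation : P ⪰bis Q → PRel
⪰bis-relation = proj₁

⪰bis-isContraction : (p : P ⪰bis Q) → IsContraction (⪰bis-relation p)
⪰bis-isContraction p = proj₁ (proj₂ p)

⪰bis-related : (p : P ⪰bis Q) → ⪰bis-relation p P Q
⪰bis-related p = proj₂ (proj₂ p)

simulate : IsWB R → R P Q → P ⟹[ α ] P′ → Σ Proc λ Q′ → Q ⟹[ α ] Q′ × R P′ Q′
simulate wb r stop = _ , stop , r
simulate wb r (step c t h) =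
  let (Q₁ , h₁ , r₁) = proj₁ (wb r) t
      (Q′ , h₂ , r₂) = simulate wb r₁ h
  in Q′ , h₁ ++⟨ c ⟩ h₂ , r₂

IsContractive : PRel → Set
IsContractive R = ∀ {A B} → R A B →
  ∀ {μ A′} → A ─[ μ ]→ A′ → Σ Proc λ B′ → B ─̂[ μ ]→ B′ × R A′ B′

⋃ : {Ix : Set} → (Ix → PRel) → PRel
⋃ R A B = Σ _ λ i → R i A B

⋃-WB : ∀ {Ix} {R : Ix → PRel} → (∀ i → IsWB (R i)) → IsWB (⋃ R)
⋃-WB wb (i , r) = (λ t → let (B′ , h , r′) = proj₁ (wb i r) t in B′ , h , (i , r′))
                 , (λ t → let (A′ , h , r′) = proj₂ (wb i r) t in A′ , h , (i , r′))

⋃-contractive : ∀ {Ix} {R : Ix → PRel} → (∀ i → IsContractive (R i)) → IsContractive (⋃ R)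
⋃-contractive sim (i , r) t = let (B′ , u , r′) = sim i r t in B′ , u , (i , r′)

-- Every contraction is contained in a weak bisimulation: itself together with
-- the bisimulations witnessing its answers to challenges from the right.
module _ {R : PRel} (isC : IsContraction R) where

  RightChallenge : Set
  RightChallenge = Σ Proc λ A → Σ Proc λ B → R A B × Σ Act λ μ → Σ Proc λ B′ → B ─[ μ ]→ B′

  answerBisim : RightChallenge → PRel
  answerBisim (_ , _ , r , _ , _ , t) = let (_ , _ , bisim) = proj₂ (isC r) t in ≈-relation bisim

  withAnswers : PRel
  withAnswers = R ∪ ⋃ answerBisim

  withAnswers-WB : IsWB withAnswers
  withAnswers-WB (inj₁ r) = left , right
    where
      left : WeakAnswers withAnswers _ _
      left t = let (B′ , u , r′) = proj₁ (isC r) t in B′ , ─̂→⟹ u , inj₁ r′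
      right : WeakAnswers (flip withAnswers) _ _
      right {μ} {B′} t = let (A′ , h , bisim) = proj₂ (isC r) t
                         in A′ , ⇒̂→⟹ h , inj₂ ((_ , _ , r , μ , B′ , t) , ≈-related bisim)
  withAnswers-WB (inj₂ x) =
    (λ t → let (B′ , h , r′) = proj₁ (⋃-WB answer-WB x) t in B′ , h , inj₂ r′) ,
    (λ t → let (A′ , h , r′) = proj₂ (⋃-WB answer-WB x) t in A′ , h , inj₂ r′)
    where
      answer-WB : ∀ c → IsWB (answerBisim c)
      answer-WB (_ , _ , r , _ , _ , t) = let (_ , _ , bisim) = proj₂ (isC r) t in ≈-isWB bisim

data Layer (R : PRel) : PRel where
  reflexive  : ∀ {A} → Layer R A A
  embed      : ∀ {A B} → R A B → Layer R A B
  transitive : ∀ {A B C} → R A B → R B C → Layer R A C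
  par-cong   : ∀ {A A′ B B′} → R A A′ → R B B′ → Layer R (par A B) (par A′ B′)
  res-cong   : ∀ {a A B} → R A B → Layer R (res a A) (res a B)
  rel-cong   : ∀ {f A B} → R A B → Layer R (rel f A) (rel f B)

layer-map : (∀ {A B} → R A B → S A B) → ∀ {A B} → Layer R A B → Layer S A B
layer-map f reflexive          = reflexive
layer-map f (embed r)          = embed (f r)
layer-map f (transitive r₁ r₂) = transitive (f r₁) (f r₂)
layer-map f (par-cong r₁ r₂)   = par-cong (f r₁) (f r₂)
layer-map f (res-cong r)       = res-cong (f r)
layer-map f (rel-cong r)       = rel-cong (f r)

layer-swap : ∀ {A B} → Layer R A B → Layer (flip R) B A
layer-swap reflexive          = reflexive
layer-swap (embed r)          = embed r
layer-swap (transitive r₁ r₂) = transitive r₂ r₁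
layer-swap (par-cong r₁ r₂)   = par-cong r₁ r₂
layer-swap (res-cong r)       = res-cong r
layer-swap (rel-cong r)       = rel-cong r

-- A layer over a weak bisimulation is again a weak bisimulation; the
-- right-hand clause follows from the left one by symmetry.
layer-answers : IsWB R → ∀ {A B} → Layer R A B → WeakAnswers (Layer R) A B
layer-answers wb reflexive t = _ , single t , reflexive
layer-answers wb (embed r) t = let (B′ , h , r′) = proj₁ (wb r) t in B′ , h , embed r′
layer-answers wb (transitive r₁ r₂) t =
  let (B₁ , h₁ , r₁′) = proj₁ (wb r₁) t
      (B′ , h₂ , r₂′) = simulate wb r₂ h₁
  in B′ , h₂ , transitive r₁′ r₂′
layer-answers wb (par-cong r₁ r₂) (parL t) =
  let (_ , h , r₁′) = proj₁ (wb r₁) t in _ , ⟹-map (lift-parL _ _) h , par-cong r₁′ r₂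
layer-answers wb (par-cong r₁ r₂) (parR t) =
  let (_ , h , r₂′) = proj₁ (wb r₂) t in _ , ⟹-map (lift-parR _ _) h , par-cong r₁ r₂′
layer-answers wb (par-cong r₁ r₂) (com₁ t s) =
  let (_ , h , r₁′) = proj₁ (wb r₁) t ; (_ , k , r₂′) = proj₁ (wb r₂) s
  in _ , forget (⟹-communicate inp-out h k) , par-cong r₁′ r₂′
layer-answers wb (par-cong r₁ r₂) (com₂ t s) =
  let (_ , h , r₁′) = proj₁ (wb r₁) t ; (_ , k , r₂′) = proj₁ (wb r₂) s
  in _ , forget (⟹-communicate out-inp h k) , par-cong r₁′ r₂′
layer-answers wb (res-cong r) (res ne t) =
  let (_ , h , r′) = proj₁ (wb r) t in _ , ⟹-map (lift-res ne) h , res-cong r′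
layer-answers wb (rel-cong r) (rel t) =
  let (_ , h , r′) = proj₁ (wb r) t in _ , ⟹-map (lift-rel _ _) h , rel-cong r′

layer-WB : IsWB R → IsWB (Layer R)
layer-WB wb r =
  layer-answers wb r ,
  λ t → let (A′ , h , r′) = layer-answers (IsWB-flip wb) (layer-swap r) t in A′ , h , layer-swap r′

layer-contractive : IsContractive R → IsContractive (Layer R)
layer-contractive sim reflexive t = _ , inj₁ t , reflexive
layer-contractive sim (embed r) t = let (B′ , u , r′) = sim r t in B′ , u , embed r′
layer-contractive sim (transitive r₁ r₂) t with sim r₁ t
... | _ , inj₂ (refl , refl) , r₁′ = _ , inj₂ (refl , refl) , transitive r₁′ r₂
... | _ , inj₁ u , r₁′ = let (C′ , v , r₂′) = sim r₂ u in C′ , v , transitive r₁′ r₂′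
layer-contractive sim (par-cong r₁ r₂) (parL t) =
  let (_ , u , r₁′) = sim r₁ t in _ , ─̂-map (lift-parL _ _) u , par-cong r₁′ r₂
layer-contractive sim (par-cong r₁ r₂) (parR t) =
  let (_ , u , r₂′) = sim r₂ t in _ , ─̂-map (lift-parR _ _) u , par-cong r₁ r₂′
layer-contractive sim (par-cong r₁ r₂) (com₁ t s) =
  let (_ , u , r₁′) = sim r₁ t ; (_ , v , r₂′) = sim r₂ s
  in _ , inj₁ (com₁ (sharpen (λ ()) u) (sharpen (λ ()) v)) , par-cong r₁′ r₂′
layer-contractive sim (par-cong r₁ r₂) (com₂ t s) =
  let (_ , u , r₁′) = sim r₁ t ; (_ , v , r₂′) = sim r₂ s
  in _ , inj₁ (com₂ (sharpen (λ ()) u) (sharpen (λ ()) v)) , par-cong r₁′ r₂′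
layer-contractive sim (res-cong r) (res ne t) =
  let (_ , u , r′) = sim r t in _ , ─̂-map (lift-res ne) u , res-cong r′
layer-contractive sim (rel-cong r) (rel t) =
  let (_ , u , r′) = sim r t in _ , ─̂-map (lift-rel _ _) u , rel-cong r′

-- Relations that contain the identity and are preserved by the static operators:
-- exactly what is needed to relate two fillings of a static context.
record StaticCongruence (R : PRel) : Set where
  field
    cong-refl : ∀ {A} → R A A
    cong-par  : ∀ {A A′ B B′} → R A A′ → R B B′ → R (par A B) (par A′ B′)
    cong-res  : ∀ {a A B} → R A B → R (res a A) (res a B)
    cong-rel  : ∀ {f A B} → R A B → R (rel f A) (rel f B)

-- The closure of R under reflexivity, transitivity and the static operators,
-- as the union of the iterated layers: stratifying by depth keeps the proof
-- that weak bisimulations are preserved a structural recursion.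
Layerⁿ : ℕ → PRel → PRel
Layerⁿ zero    R = R
Layerⁿ (suc n) R = Layer (Layerⁿ n R)

Closure : PRel → PRel
Closure R = ⋃ λ n → Layerⁿ n R

module _ {R : PRel} where

  private
    raise : ∀ {m n A B} → m ≤′ n → Layerⁿ m R A B → Layerⁿ n R A B
    raise ≤′-refl      r = r
    raise (≤′-step le) r = embed (raise le r)

    align : ∀ {A B C D} → Closure R A B → Closure R C D → Σ ℕ λ n → Layerⁿ n R A B × Layerⁿ n R C D
    align (m , r) (n , r′) = m ⊔ n , raise (≤⇒≤′ (m≤m⊔n m n)) r , raise (≤⇒≤′ (m≤n⊔m m n)) r′

  closure-base : ∀ {A B} → R A B → Closure R A B
  closure-base r = 0 , r

  closure-≡ : ∀ {A B} → A ≡ B → Closure R A B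
  closure-≡ refl = 1 , reflexive

  closure-trans : ∀ {A B C} → Closure R A B → Closure R B C → Closure R A C
  closure-trans x y = let (n , r , r′) = align x y in suc n , transitive r r′

  closure-congruence : StaticCongruence (Closure R)
  closure-congruence = record
    { cong-refl = closure-≡ refl
    ; cong-par  = λ x y → let (n , r , r′) = align x y in suc n , par-cong r r′
    ; cong-res  = λ { (n , r) → suc n , res-cong r }
    ; cong-rel  = λ { (n , r) → suc n , rel-cong r }
    }

closure-mono : (∀ {A B} → R A B → S A B) → ∀ {A B} → Closure R A B → Closure S A B
closure-mono f (n , r) = n , iterate n r
  where
    iterate : ∀ n {A B} → Layerⁿ n _ A B → Layerⁿ n _ A B
    iterate zero    = f
    iterate (suc n) = layer-map (iterate n)

closure-WB : IsWB R → IsWB (Closure R)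
closure-WB wb = ⋃-WB level-WB
  where
    level-WB : ∀ n → IsWB (Layerⁿ n _)
    level-WB zero    = wb
    level-WB (suc n) = layer-WB (level-WB n)

closure-contractive : IsContractive R → IsContractive (Closure R)
closure-contractive sim = ⋃-contractive level-contractive
  where
    level-contractive : ∀ n → IsContractive (Layerⁿ n _)
    level-contractive zero    = sim
    level-contractive (suc n) = layer-contractive (level-contractive n)

-- Syntax: renaming and substitution of recursion constants commute with the
-- substitution of processes for equation variables; this is what lets a step
-- of rec B be read off the unfolding of B before or after the substitution.
ren-fusion : ∀ {V n m k} (r₀ : Fin n → Fin m) (r : Fin m → Fin k) (r₁ : Fin n → Fin k) →
  (∀ i → r (r₀ i) ≡ r₁ i) → (p : Expr V n) → ren r (ren r₀ p) ≡ ren r₁ p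
ren-fusion r₀ r r₁ h nil       = refl
ren-fusion r₀ r r₁ h (pre μ p) = cong (pre μ) (ren-fusion r₀ r r₁ h p)
ren-fusion r₀ r r₁ h (par p q) = cong₂ par (ren-fusion r₀ r r₁ h p) (ren-fusion r₀ r r₁ h q)
ren-fusion r₀ r r₁ h (sum p q) = cong₂ sum (ren-fusion r₀ r r₁ h p) (ren-fusion r₀ r r₁ h q)
ren-fusion r₀ r r₁ h (res a p) = cong (res a) (ren-fusion r₀ r r₁ h p)
ren-fusion r₀ r r₁ h (cst i)   = cong cst (h i)
ren-fusion r₀ r r₁ h (rec p)   = cong rec (ren-fusion (ext r₀) (ext r) (ext r₁) h′ p)
  where
    h′ : ∀ i → ext r (ext r₀ i) ≡ ext r₁ i
    h′ zero    = refl
    h′ (suc i) = cong suc (h i)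
ren-fusion r₀ r r₁ h (rel f p) = cong (rel f) (ren-fusion r₀ r r₁ h p)
ren-fusion r₀ r r₁ h (var x)   = refl

ren-identity : ∀ {V n} (r : Fin n → Fin n) → (∀ i → r i ≡ i) → (p : Expr V n) → ren r p ≡ p
ren-identity r h nil       = refl
ren-identity r h (pre μ p) = cong (pre μ) (ren-identity r h p)
ren-identity r h (par p q) = cong₂ par (ren-identity r h p) (ren-identity r h q)
ren-identity r h (sum p q) = cong₂ sum (ren-identity r h p) (ren-identity r h q)
ren-identity r h (res a p) = cong (res a) (ren-identity r h p)
ren-identity r h (cst i)   = cong cst (h i)
ren-identity r h (rec p)   = cong rec (ren-identity (ext r) h′ p)
  where
    h′ : ∀ i → ext r i ≡ i
    h′ zero    = refl
    h′ (suc i) = cong suc (h i)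
ren-identity r h (rel f p) = cong (rel f) (ren-identity r h p)
ren-identity r h (var x)   = refl

subst-ren : ∀ {V n m k} (r : Fin n → Fin m) (ρ : Fin m → Expr V k) (r′ : Fin n → Fin k) →
  (∀ i → ρ (r i) ≡ cst (r′ i)) → (p : Expr V n) → subst ρ (ren r p) ≡ ren r′ p
subst-ren r ρ r′ h nil       = refl
subst-ren r ρ r′ h (pre μ p) = cong (pre μ) (subst-ren r ρ r′ h p)
subst-ren r ρ r′ h (par p q) = cong₂ par (subst-ren r ρ r′ h p) (subst-ren r ρ r′ h q)
subst-ren r ρ r′ h (sum p q) = cong₂ sum (subst-ren r ρ r′ h p) (subst-ren r ρ r′ h q)
subst-ren r ρ r′ h (res a p) = cong (res a) (subst-ren r ρ r′ h p)
subst-ren r ρ r′ h (cst i)   = h i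
subst-ren r ρ r′ h (rec p)   = cong rec (subst-ren (ext r) (exts ρ) (ext r′) h′ p)
  where
    h′ : ∀ i → exts ρ (ext r i) ≡ cst (ext r′ i)
    h′ zero    = refl
    h′ (suc i) = cong (ren suc) (h i)
subst-ren r ρ r′ h (rel f p) = cong (rel f) (subst-ren r ρ r′ h p)
subst-ren r ρ r′ h (var x)   = refl

closeAt-id : (p : Proc) → closeAt {zero} p ≡ p
closeAt-id p = ren-identity (λ ()) (λ ()) p

module _ {V : Set} (σ : V → Proc) where

  substX-ren : ∀ {n m} (r : Fin n → Fin m) (B : Expr V n) → substX σ (ren r B) ≡ ren r (substX σ B)
  substX-ren r nil       = refl
  substX-ren r (pre μ p) = cong (pre μ) (substX-ren r p)
  substX-ren r (par p q) = cong₂ par (substX-ren r p) (substX-ren r q)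
  substX-ren r (sum p q) = cong₂ sum (substX-ren r p) (substX-ren r q)
  substX-ren r (res a p) = cong (res a) (substX-ren r p)
  substX-ren r (cst i)   = refl
  substX-ren r (rec p)   = cong rec (substX-ren (ext r) p)
  substX-ren r (rel f p) = cong (rel f) (substX-ren r p)
  substX-ren r (var x)   = sym (ren-fusion (λ ()) r (λ ()) (λ ()) (σ x))

  substX-subst : ∀ {n m} (ρ : Fin n → Expr V m) (ρ′ : Fin n → Expr ⊥ m) →
    (∀ i → ρ′ i ≡ substX σ (ρ i)) → (B : Expr V n) → substX σ (subst ρ B) ≡ subst ρ′ (substX σ B)
  substX-subst ρ ρ′ h nil       = refl
  substX-subst ρ ρ′ h (pre μ p) = cong (pre μ) (substX-subst ρ ρ′ h p)
  substX-subst ρ ρ′ h (par p q) = cong₂ par (substX-subst ρ ρ′ h p) (substX-subst ρ ρ′ h q)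
  substX-subst ρ ρ′ h (sum p q) = cong₂ sum (substX-subst ρ ρ′ h p) (substX-subst ρ ρ′ h q)
  substX-subst ρ ρ′ h (res a p) = cong (res a) (substX-subst ρ ρ′ h p)
  substX-subst ρ ρ′ h (cst i)   = sym (h i)
  substX-subst ρ ρ′ h (rec p)   = cong rec (substX-subst (exts ρ) (exts ρ′) h′ p)
    where
      h′ : ∀ i → exts ρ′ i ≡ substX σ (exts ρ i)
      h′ zero    = refl
      h′ (suc i) = trans (cong (ren suc) (h i)) (sym (substX-ren suc (ρ i)))
  substX-subst ρ ρ′ h (rel f p) = cong (rel f) (substX-subst ρ ρ′ h p)
  substX-subst ρ ρ′ h (var x)   = sym (subst-ren (λ ()) ρ′ (λ ()) (λ ()) (σ x))

unfoldE : ∀ {V} → Expr V (suc zero) → Expr V zero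
unfoldE B = subst (λ _ → rec B) B

substX-unfold : ∀ {V} (σ : V → Proc) (B : Expr V (suc zero)) → substX σ (unfoldE B) ≡ unfold (substX σ B)
substX-unfold σ B = substX-subst σ (λ _ → rec B) (λ _ → rec (substX σ B)) (λ _ → refl) B

guarded-ren : ∀ {V n m} (r : Fin n → Fin m) {B : Expr V n} → WeaklyGuarded B → WeaklyGuarded (ren r B)
guarded-ren r nil        = nil
guarded-ren r (pre μ _)  = pre μ _
guarded-ren r (par g g′) = par (guarded-ren r g) (guarded-ren r g′)
guarded-ren r (sum g g′) = sum (guarded-ren r g) (guarded-ren r g′)
guarded-ren r (res a g)  = res a (guarded-ren r g)
guarded-ren r (cst i)    = cst (r i)
guarded-ren r (rec g)    = rec (guarded-ren (ext r) g)
guarded-ren r (rel f g)  = rel f (guarded-ren r g)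

guarded-subst : ∀ {V n m} (ρ : Fin n → Expr V m) → (∀ i → WeaklyGuarded (ρ i)) →
  {B : Expr V n} → WeaklyGuarded B → WeaklyGuarded (subst ρ B)
guarded-subst ρ h nil        = nil
guarded-subst ρ h (pre μ _)  = pre μ _
guarded-subst ρ h (par g g′) = par (guarded-subst ρ h g) (guarded-subst ρ h g′)
guarded-subst ρ h (sum g g′) = sum (guarded-subst ρ h g) (guarded-subst ρ h g′)
guarded-subst ρ h (res a g)  = res a (guarded-subst ρ h g)
guarded-subst ρ h (cst i)    = h i
guarded-subst ρ h (rec g)    = rec (guarded-subst (exts ρ) h′ g)
  where
    h′ : ∀ i → WeaklyGuarded (exts ρ i)
    h′ zero    = cst zero
    h′ (suc i) = guarded-ren suc (h i)
guarded-subst ρ h (rel f g)  = rel f (guarded-subst ρ h g)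

guarded-unfold : ∀ {V} {B : Expr V (suc zero)} → WeaklyGuarded B → WeaklyGuarded (unfoldE B)
guarded-unfold g = guarded-subst _ (λ _ → rec g) g

-- Guarded steps: a step of C[σ̃] for weakly guarded C is a step of C itself,
-- so it can be performed under every substitution. The equation argument keeps
-- the transition as the decreasing argument when unfolding rec.
guarded-step : ∀ {V} (σ : V → Proc) (C : Expr V zero) → WeaklyGuarded C →
  ∀ {T α X} → T ≡ substX σ C → T ─[ α ]→ X →
  Σ (Expr V zero) λ C′ → X ≡ substX σ C′ × (∀ θ → substX θ C ─[ α ]→ substX θ C′)
guarded-step σ nil       _ refl ()
guarded-step σ (pre μ B) _ refl (pre _ _) = B , refl , λ θ → pre μ _
guarded-step σ (par C D) (par g g′) refl (parL t) =
  let (C′ , e , u) = guarded-step σ C g refl t in par C′ D , cong (λ X → par X _) e , λ θ → parL (u θ)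
guarded-step σ (par C D) (par g g′) refl (parR t) =
  let (D′ , e , u) = guarded-step σ D g′ refl t in par C D′ , cong (par _) e , λ θ → parR (u θ)
guarded-step σ (par C D) (par g g′) refl (com₁ t s) =
  let (C′ , e , u) = guarded-step σ C g refl t ; (D′ , e′ , u′) = guarded-step σ D g′ refl s
  in par C′ D′ , cong₂ par e e′ , λ θ → com₁ (u θ) (u′ θ)
guarded-step σ (par C D) (par g g′) refl (com₂ t s) =
  let (C′ , e , u) = guarded-step σ C g refl t ; (D′ , e′ , u′) = guarded-step σ D g′ refl s
  in par C′ D′ , cong₂ par e e′ , λ θ → com₂ (u θ) (u′ θ)
guarded-step σ (sum C D) (sum g g′) refl (sumL t) =
  let (C′ , e , u) = guarded-step σ C g refl t in C′ , e , λ θ → sumL (u θ)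
guarded-step σ (sum C D) (sum g g′) refl (sumR t) =
  let (D′ , e , u) = guarded-step σ D g′ refl t in D′ , e , λ θ → sumR (u θ)
guarded-step σ (res a C) (res _ g) refl (res ne t) =
  let (C′ , e , u) = guarded-step σ C g refl t in res a C′ , cong (res a) e , λ θ → res ne (u θ)
guarded-step σ (rel f C) (rel _ g) refl (rel t) =
  let (C′ , e , u) = guarded-step σ C g refl t in rel f C′ , cong (rel f) e , λ θ → rel (u θ)
guarded-step σ (rec B) (rec g) refl (rec t) =
  let (C′ , e , u) = guarded-step σ (unfoldE B) (guarded-unfold g) (sym (substX-unfold σ B)) t
  in C′ , e , λ θ → rec (Eq.subst (_─[ _ ]→ substX θ C′) (substX-unfold θ B) (u θ))
guarded-step σ (cst ()) _ _ _
guarded-step σ (var x) () _ _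

data Context (V : Set) : Set → Set₁ where
  hole : Context V ⊤
  leaf : Expr V zero → Context V ⊥
  par  : ∀ {H₁ H₂} → Context V H₁ → Context V H₂ → Context V (H₁ ⊎ H₂)
  res  : ∀ {H} → Name → Context V H → Context V H
  rel  : ∀ {H} → (Name → Name) → Context V H → Context V H

module _ {V : Set} where

  plug : ∀ {H} → (V → Proc) → (H → Proc) → Context V H → Proc
  plug σ f hole        = f tt
  plug σ f (leaf C)    = substX σ C
  plug σ f (par K₁ K₂) = par (plug σ (f ∘ inj₁) K₁) (plug σ (f ∘ inj₂) K₂)
  plug σ f (res a K)   = res a (plug σ f K)
  plug σ f (rel g K)   = rel g (plug σ f K)

  fill : ∀ {H} → Context V H → (H → Expr V zero) → Expr V zero
  fill hole        e = e tt
  fill (leaf C)    e = C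
  fill (par K₁ K₂) e = par (fill K₁ (e ∘ inj₁)) (fill K₂ (e ∘ inj₂))
  fill (res a K)   e = res a (fill K e)
  fill (rel g K)   e = rel g (fill K e)

  plug-fill : ∀ {H} σ (e : H → Expr V zero) K → plug σ (substX σ ∘ e) K ≡ substX σ (fill K e)
  plug-fill σ e hole        = refl
  plug-fill σ e (leaf C)    = refl
  plug-fill σ e (par K₁ K₂) = cong₂ par (plug-fill σ (e ∘ inj₁) K₁) (plug-fill σ (e ∘ inj₂) K₂)
  plug-fill σ e (res a K)   = cong (res a) (plug-fill σ e K)
  plug-fill σ e (rel g K)   = cong (rel g) (plug-fill σ e K)

  plug-mono : ∀ {H} {f g : H → Proc} → StaticCongruence R → ∀ σ →
    (∀ h → R (f h) (g h)) → ∀ K → R (plug σ f K) (plug σ g K)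
  plug-mono C σ fg hole        = fg tt
  plug-mono C σ fg (leaf _)    = StaticCongruence.cong-refl C
  plug-mono C σ fg (par K₁ K₂) =
    StaticCongruence.cong-par C (plug-mono C σ (fg ∘ inj₁) K₁) (plug-mono C σ (fg ∘ inj₂) K₂)
  plug-mono C σ fg (res a K)   = StaticCongruence.cong-res C (plug-mono C σ fg K)
  plug-mono C σ fg (rel g K)   = StaticCongruence.cong-rel C (plug-mono C σ fg K)

record Move {V : Set} (σ : V → Proc) : Set where
  constructor move
  field
    moving     : V
    action     : Act
    target     : Proc
    transition : σ moving ─[ action ]→ target
open Move

-- Decomposition of a step C[σ̃] ─α→ X (C arbitrary): the step is made by the
-- leaves of a static context together with moves of the substituted processes
-- in its holes, and replaying the holes' moves weakly under any θ̃ replays the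
-- whole step weakly.
record Decomposition {V : Set} (σ : V → Proc) (C : Expr V zero) (α : Act) (X : Proc) : Set₁ where
  field
    Holes   : Set
    context : Context V Holes
    moves   : Holes → Move σ
    result  : X ≡ plug σ (target ∘ moves) context
    replay  : ∀ θ (Q′ : Holes → Proc) → (∀ h → θ (moving (moves h)) ⟹⁺[ action (moves h) ] Q′ h) →
              substX θ C ⟹⁺[ α ] plug θ Q′ context

retarget : ∀ {V} {σ : V → Proc} {C C′ α X} →
  (∀ θ {T} → substX θ C ⟹⁺[ α ] T → substX θ C′ ⟹⁺[ α ] T) →
  Decomposition σ C α X → Decomposition σ C′ α X
retarget f d = record
  { Holes = Holes ; context = context ; moves = moves ; result = result
  ; replay = λ θ Q′ hs → f θ (replay θ Q′ hs) }
  where open Decomposition d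

synchronise : ∀ {V} {σ : V → Proc} {C D μ ν X₁ X₂} → Complementary μ ν →
  Decomposition σ C μ X₁ → Decomposition σ D ν X₂ → Decomposition σ (par C D) τ (par X₁ X₂)
synchronise k d₁ d₂ = record
  { Holes = D₁.Holes ⊎ D₂.Holes ; context = par D₁.context D₂.context
  ; moves = [ D₁.moves , D₂.moves ] ; result = cong₂ par D₁.result D₂.result
  ; replay = λ θ Q′ hs → ⟹-communicate k (forget (D₁.replay θ (Q′ ∘ inj₁) (hs ∘ inj₁)))
                                         (forget (D₂.replay θ (Q′ ∘ inj₂) (hs ∘ inj₂))) }
  where
    module D₁ = Decomposition d₁
    module D₂ = Decomposition d₂

-- Every step of C[σ̃] decomposes; as for guarded-step, the equation argument
-- keeps the transition as the decreasing argument when unfolding rec.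
decompose : ∀ {V} (σ : V → Proc) (C : Expr V zero) {T α X} →
  T ≡ substX σ C → T ─[ α ]→ X → Decomposition σ C α X
decompose σ nil refl ()
decompose σ (pre μ B) refl (pre _ _) = record
  { Holes = ⊥ ; context = leaf B ; moves = λ () ; result = refl
  ; replay = λ _ _ _ → step⁺ ·τ (pre μ _) stop }
decompose σ (sum C D) refl (sumL t) = retarget (λ _ → ⟹⁺-redirect sumL) (decompose σ C refl t)
decompose σ (sum C D) refl (sumR t) = retarget (λ _ → ⟹⁺-redirect sumR) (decompose σ D refl t)
decompose σ (par C D) refl (parL t) = let open Decomposition (decompose σ C refl t) in record
  { Holes = Holes ⊎ ⊥ ; context = par context (leaf D) ; moves = [ moves , (λ ()) ]
  ; result = cong (λ X → par X _) result
  ; replay = λ θ Q′ hs → ⟹⁺-map (lift-parL _ _) (replay θ (Q′ ∘ inj₁) (hs ∘ inj₁)) }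
decompose σ (par C D) refl (parR t) = let open Decomposition (decompose σ D refl t) in record
  { Holes = ⊥ ⊎ Holes ; context = par (leaf C) context ; moves = [ (λ ()) , moves ]
  ; result = cong (par _) result
  ; replay = λ θ Q′ hs → ⟹⁺-map (lift-parR _ _) (replay θ (Q′ ∘ inj₂) (hs ∘ inj₂)) }
decompose σ (par C D) refl (com₁ t s) = synchronise inp-out (decompose σ C refl t) (decompose σ D refl s)
decompose σ (par C D) refl (com₂ t s) = synchronise out-inp (decompose σ C refl t) (decompose σ D refl s)
decompose σ (res a C) refl (res ne t) = let open Decomposition (decompose σ C refl t) in record
  { Holes = Holes ; context = res a context ; moves = moves ; result = cong (res a) result
  ; replay = λ θ Q′ hs → ⟹⁺-map (lift-res ne) (replay θ Q′ hs) }
decompose σ (rel f C) refl (rel t) = let open Decomposition (decompose σ C refl t) in record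
  { Holes = Holes ; context = rel f context ; moves = moves ; result = cong (rel f) result
  ; replay = λ θ Q′ hs → ⟹⁺-map (lift-rel _ _) (replay θ Q′ hs) }
decompose σ (rec B) refl (rec t) =
  retarget (λ θ → ⟹⁺-redirect rec ∘ Eq.subst (_⟹⁺[ _ ] _) (substX-unfold θ B))
           (decompose σ (unfoldE B) (sym (substX-unfold σ B)) t)
decompose σ (cst ()) _ _
decompose σ (var x) {α = α} {X} refl t = record
  { Holes = ⊤ ; context = hole ; moves = λ _ → move x α X (Eq.subst (_─[ α ]→ X) (closeAt-id (σ x)) t)
  ; result = refl
  ; replay = λ θ Q′ hs → Eq.subst (_⟹⁺[ α ] Q′ tt) (sym (closeAt-id (θ x))) (hs tt) }

module UniqueSolution {I : Set} (E : I → Expr I zero) (guarded : ∀ i → WeaklyGuarded (E i))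
  (P Q : I → Proc) (P-solves : ∀ i → P i ⪰ᶜbis (E i [ P ])) (Q-solves : ∀ i → Q i ⪰ᶜbis (E i [ Q ])) where

  -- The two solutions, so that each argument is written once for both directions.
  data Side : Set where
    P-side Q-side : Side

  solution : Side → I → Proc
  solution P-side = P
  solution Q-side = Q

  solves : ∀ s i → solution s i ⪰ᶜbis (E i [ solution s ])
  solves P-side = P-solves
  solves Q-side = Q-solves

  -- A step of a solution component; the hypothesis answers it by a step of the
  -- equation body up to a contraction.
  SolutionStep : Set
  SolutionStep = Σ Side λ s → Σ I λ i → Σ Act λ μ → Σ Proc λ P′ → solution s i ─[ μ ]→ P′

  stepContraction : SolutionStep → PRel
  stepContraction (s , i , _ , _ , t) = let (_ , _ , c) = proj₁ (solves s i) t in ⪰bis-relation c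

  stepContraction-isC : ∀ c → IsContraction (stepContraction c)
  stepContraction-isC (s , i , _ , _ , t) = let (_ , _ , c) = proj₁ (solves s i) t in ⪰bis-isContraction c

  -- A step of an equation body; the hypothesis answers it by a weak transition
  -- of the solution component up to weak bisimilarity.
  BodyStep : Set
  BodyStep = Σ Side λ s → Σ I λ i → Σ Act λ μ → Σ Proc λ F → E i [ solution s ] ─[ μ ]→ F

  bodyBisim : BodyStep → PRel
  bodyBisim (s , i , _ , _ , u) = let (_ , _ , b) = proj₂ (solves s i) u in ≈-relation b

  -- ≈ is a large relation; instead we work with the small weak bisimulation
  -- generated by all the witnesses that the hypotheses provide.
  witness : SolutionStep ⊎ BodyStep → PRel
  witness (inj₁ c) = withAnswers (stepContraction-isC c)
  witness (inj₂ b) = bodyBisim b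

  witness-WB : ∀ w → IsWB (witness w)
  witness-WB (inj₁ c) = withAnswers-WB (stepContraction-isC c)
  witness-WB (inj₂ (s , i , _ , _ , u)) = let (_ , _ , b) = proj₂ (solves s i) u in ≈-isWB b

  infix 4 _≋_ _⪰_
  _≋_ : PRel
  _≋_ = Closure (⋃ witness)

  ≋-WB : IsWB _≋_
  ≋-WB = closure-WB (⋃-WB witness-WB)

  -- Likewise for the contractions provided by the hypotheses.
  _⪰_ : PRel
  _⪰_ = Closure (⋃ stepContraction)

  -- Of the contractions only their left clause survives the closure; it is all
  -- the matching argument needs, together with their inclusion in ≋.
  ⪰-contractive : IsContractive _⪰_
  ⪰-contractive = closure-contractive (⋃-contractive λ c r → proj₁ (stepContraction-isC c r))

  ⪰⇒≋ : ∀ {A B} → A ⪰ B → A ≋ B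
  ⪰⇒≋ = closure-mono λ { (c , r) → inj₁ c , inj₁ r }

  -- X, a derivative on side s, is matched from side s′ by a transition Reply
  -- leading to a process related to C₁[side s′], where X ⪰ C₁[side s].
  record Matched (s s′ : Side) (Reply : Proc → Set) (X : Proc) : Set where
    field
      residual   : Expr I zero
      contracted : X ⪰ substX (solution s) residual
      response   : Proc
      reply      : Reply response
      bisimilar  : response ≋ substX (solution s′) residual
  open Matched

  -- A move of a solution component: answered by the equation body up to
  -- contraction, which by weak guardedness is a move of the body itself, and
  -- thus answered in turn by the other solution.
  answer-move : ∀ s s′ {i μ P′} → solution s i ─[ μ ]→ P′ → Matched s s′ (solution s′ i ⇒[ μ ]_) P′
  answer-move s s′ {i} {μ} {P′} t =
    let (F , u , contraction) = proj₁ (solves s i) t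
        (C₁ , F≡ , u′) = guarded-step (solution s) (E i) (guarded i) refl u
        (S , w , bisim) = proj₂ (solves s′ i) (u′ (solution s′))
    in record
      { residual   = C₁
      ; contracted = Eq.subst (P′ ⪰_) F≡ (closure-base ((s , i , μ , P′ , t) , ⪰bis-related contraction))
      ; response   = S
      ; reply      = w
      ; bisimilar  = closure-base (inj₂ (s′ , i , μ , _ , u′ (solution s′)) , ≈-related bisim)
      }

  -- A step of C[side s], for any C: decompose it into moves of the variables,
  -- answer each of them, and reassemble the answers in the static context.
  match-step : ∀ s s′ (C : Expr I zero) {β X} → substX (solution s) C ─[ β ]→ X →
    Matched s s′ (substX (solution s′) C ⟹⁺[ β ]_) X
  match-step s s′ C t = record
    { residual   = fill context (residual ∘ answer)
    ; contracted = Eq.subst₂ _⪰_ (sym result) (plug-fill (solution s) (residual ∘ answer) context)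
                     (plug-mono closure-congruence (solution s) (contracted ∘ answer) context)
    ; response   = plug (solution s′) (response ∘ answer) context
    ; reply      = replay (solution s′) (response ∘ answer) (λ h → ⇒→⟹⁺ (reply (answer h)))
    ; bisimilar  = Eq.subst (plug (solution s′) (response ∘ answer) context ≋_)
                     (plug-fill (solution s′) (residual ∘ answer) context)
                     (plug-mono closure-congruence (solution s′) (bisimilar ∘ answer) context)
    }
    where
      open Decomposition (decompose (solution s) C refl t)
      answer : (h : Holes) →
        Matched s s′ (solution s′ (moving (moves h)) ⇒[ action (moves h) ]_) (target (moves h))
      answer h = answer-move s s′ (transition (moves h))

  -- The same for weak transitions of a process contracting to C[side s]:
  -- by induction on the transition, contracting after each step.
  match-trace : ∀ s s′ (C : Expr I zero) {A α X} → A ⪰ substX (solution s) C → A ⟹[ α ] X →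
    Matched s s′ (substX (solution s′) C ⟹[ α ]_) X
  match-trace s s′ C r stop =
    record { residual = C ; contracted = r ; response = _ ; reply = stop ; bisimilar = closure-≡ refl }
  match-trace s s′ C r (step c t h) with ⪰-contractive r t
  ... | _ , inj₂ (refl , refl) , r₁ =
    let m = match-trace s s′ C r₁ h
    in record { residual = residual m ; contracted = contracted m ; response = response m
              ; reply = stop ++⟨ c ⟩ reply m ; bisimilar = bisimilar m }
  ... | _ , inj₁ u , r₁ =
    let m₁ = match-step s s′ C u
        m₂ = match-trace s s′ (residual m₁) (closure-trans r₁ (contracted m₁)) h
        (S , h₃ , e₃) = simulate (IsWB-flip ≋-WB) (bisimilar m₁) (reply m₂)
    in record { residual = residual m₂ ; contracted = contracted m₂ ; response = S
              ; reply = forget (reply m₁) ++⟨ c ⟩ h₃ ; bisimilar = closure-trans e₃ (bisimilar m₂) }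

  SameContext : Side → Side → PRel
  SameContext s s′ A B = Σ (Expr I zero) λ C → A ≋ substX (solution s) C × B ≋ substX (solution s′) C

  same-context-swap : ∀ {s s′ A B} → SameContext s s′ A B → SameContext s′ s B A
  same-context-swap (C , eA , eB) = C , eB , eA

  -- A step of A is matched weakly by C[side s], that weak transition by
  -- C[side s′] up to ⪰ and ≋, and the result in turn by B.
  same-context-answers : ∀ s s′ {A B} → SameContext s s′ A B → WeakAnswers (SameContext s s′) A B
  same-context-answers s s′ (C , eA , eB) t =
    let (A₁ , h , e₁) = proj₁ (≋-WB eA) t
        m = match-trace s s′ C (closure-≡ refl) h
        (B′ , hB , eB′) = simulate (IsWB-flip ≋-WB) eB (reply m)
    in B′ , hB , (residual m , closure-trans e₁ (⪰⇒≋ (contracted m)) , closure-trans eB′ (bisimilar m))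

  -- SameContext is a weak bisimulation, the right clause being the left one
  -- with the sides exchanged.
  same-context-≈ : ∀ {s s′ A B} → SameContext s s′ A B → A ≈ B
  same-context-≈ {s} {s′} r = SameContext s s′ , toIsWeakBisim same-context-WB , r
    where
      same-context-WB : IsWB (SameContext s s′)
      same-context-WB r = same-context-answers s s′ r ,
        λ t → let (A′ , h , r′) = same-context-answers s′ s (same-context-swap r) t
              in A′ , h , same-context-swap r′

  rooted : ∀ s s′ i {μ P′} → solution s i ─[ μ ]→ P′ →
    Σ Proc λ Q′ → solution s′ i ⇒[ μ ] Q′ × SameContext s s′ P′ Q′
  rooted s s′ i t = let m = answer-move s s′ t in
    response m , reply m , (residual m , ⪰⇒≋ (contracted m) , bisimilar m)

  -- Pᵢ and Qᵢ are rooted bisimilar, and bisimilar as instances of the context Xᵢ.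
  unique : ∀ i → (P i ≈ᶜ Q i) × (P i ≈ Q i)
  unique i =
    ( (λ t → let (Q′ , w , r) = rooted P-side Q-side i t in Q′ , w , same-context-≈ r)
    , (λ t → let (P′ , w , r) = rooted Q-side P-side i t in P′ , w , same-context-≈ (same-context-swap r)) )
    , same-context-≈ (var i , closure-≡ (sym (closeAt-id (P i))) , closure-≡ (sym (closeAt-id (Q i))))

theorem3p13 : (I : Set) → Countable I →
    (E : I → Expr I zero) → (∀ i → WeaklyGuarded (E i)) →
    (P Q : I → Proc) →
    (∀ i → P i ⪰ᶜbis (E i [ P ])) →
    (∀ i → Q i ⪰ᶜbis (E i [ Q ])) →
    ∀ i → (P i ≈ᶜ Q i) × (P i ≈ Q i)
theorem3p13 I _ E guarded P Q P-solves Q-solves = UniqueSolution.unique E guarded P Q P-solves Q-solves
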